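{- For all positive integers $m$, $k$ and $c$, $ex_k(m, P_{k,c}) = (c-1)\binom{m}{k}$.
   Context: $P_{r,c}$ denotes the $r\times c$ matrix all of whose entries are one. A $0-1$ matrix $A$ contains a $0-1$ matrix $M$ if some submatrix of $A$ can be transformed into $M$ by changing some ones to zeroes; otherwise $A$ avoids $M$. $ex_k(m,P)$ is the maximum number of columns in a $0-1$ matrix with $m$ rows that avoids $P$ and has at least $k$ ones in every column. -}

module Defs where

open import Data.Nat using (ℕ; zero; suc; _+_; _≤_)
open import Data.Fin using (Fin; zero; suc; _<_)
open import Data.Bool using (Bool; true; false)
open import Data.Product using (Σ; ∃; _×_)
open import Relation.Nullary using (¬_)
open import Relation.Binary.PropositionalEquality using (_≡_)

-- A 0-1 matrix with m rows and n columns (true = one, false = zero).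
Matrix : ℕ → ℕ → Set
Matrix m n = Fin m → Fin n → Bool

ones : ∀ {m} → (Fin m → Bool) → ℕ
ones {zero} v = 0
ones {suc m} v with v zero
... | true  = suc (ones (λ i → v (suc i)))
... | false = ones (λ i → v (suc i))

column : ∀ {m n} → Matrix m n → Fin n → (Fin m → Bool)
column A j i = A i j

StrictlyIncreasing : ∀ {a b} → (Fin a → Fin b) → Set
StrictlyIncreasing f = ∀ i j → i < j → f i < f j

-- A contains M: some submatrix of A (rows f, columns g, in order) has a one
-- wherever M has a one (i.e. turns into M after changing some ones to zeroes).
Contains : ∀ {m n r c} → Matrix m n → Matrix r c → Set
Contains {m} {n} {r} {c} A M =
  Σ (Fin r → Fin m) λ f → Σ (Fin c → Fin n) λ g →
    StrictlyIncreasing f × StrictlyIncreasing g ×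
    (∀ i j → M i j ≡ true → A (f i) (g j) ≡ true)

Avoids : ∀ {m n r c} → Matrix m n → Matrix r c → Set
Avoids A M = ¬ Contains A M

AllOnes : (r c : ℕ) → Matrix r c
AllOnes r c _ _ = true

Admissible : ∀ {m n r c} → ℕ → Matrix r c → Matrix m n → Set
Admissible k P A = Avoids A P × (∀ j → k ≤ ones (column A j))

IsExK : ℕ → (m : ℕ) → ∀ {r c} → Matrix r c → ℕ → Set
IsExK k m P N =
  (Σ (Matrix m N) λ A → Admissible k P A) ×
  (∀ n (A : Matrix m n) → Admissible k P A → n ≤ N)

module Submission where

-- Columns are handled through "k-sets": Boolean vectors of length m with
-- exactly k ones.  A 0-1 function has at least c ones exactly when it admits
-- an increasing selection of c positions where it is one (select and
-- selection⇒≤).  For a matrix whose columns are k-sets this gives a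
-- dictionary: the matrix contains P_{k,c} iff some k-set occurs as at least
-- c columns (repeated⇒contains and contains⇒repeated; the second direction
-- uses that two k-sets sharing k ones are equal).
--
-- Upper bound: shrink every column of an admissible matrix to a k-set below
-- it; no k-set can then occur c times, so by a general pigeonhole principle
-- over the list kSets m k of all C(m,k) k-sets there are at most
-- (c-1)·C(m,k) columns.  Lower bound: take every k-set exactly c-1 times.

open import Defs
open import Data.Nat using (ℕ; _≤_; _*_; _∸_)
open import Data.Nat.Combinatorics using (_C_)
open import Data.Nat as ℕ using (zero; suc; _+_; z≤n; s≤s; s≤s⁻¹; s<s⁻¹)
open import Data.Nat.Properties
  using (≤-refl; ≤-reflexive; ≤-trans; <-irrefl; ≮⇒≥; m≤n⇒m≤1+n; m≤n+m;
         +-mono-≤; +-monoʳ-≤; +-suc; +-assoc; +-identityʳ; *-suc; *-monoʳ-≤; *-identityʳ;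
         suc-injective; module ≤-Reasoning)
open import Data.Nat.Combinatorics using (nCk≡nC[n∸k]; nCn≡1; k>n⇒nCk≡0; nCk+nC[k+1]≡[n+1]C[k+1])
open import Data.Fin as Fin using (Fin)
open import Data.Bool as Bool using (Bool; true; false; _∧_)
open import Data.Bool.Properties using (∧-comm)
open import Data.Vec as Vec using (Vec; []; _∷_; zipWith; replicate)
open import Data.Vec.Properties using (≡-dec; zipWith-comm; lookup-zipWith; lookup-replicate)
open import Data.List as List using (List; []; _∷_; _++_; length; map; concat; tabulate)
open import Data.List.Properties using (length-++; length-map; length-tabulate; tabulate-lookup)
open import Data.List.Relation.Unary.All as All using (All; []; _∷_)
open import Data.List.Relation.Unary.All.Properties using (++⁺; map⁺; tabulate⁺; concat⁺; replicate⁺)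
open import Data.List.Relation.Unary.Any using (here; there)
open import Data.List.Membership.Propositional using (_∈_)
open import Data.List.Membership.Propositional.Properties using (∈-map⁺; ∈-++⁺ˡ; ∈-++⁺ʳ; ∈-lookup)
open import Data.Product using (Σ; _×_; _,_; proj₁; proj₂)
open import Data.Empty using (⊥-elim)
open import Function using (_∘_)
open import Relation.Nullary using (yes; no; does; ¬?)
open import Relation.Nullary.Decidable using (dec-true)
open import Relation.Binary.Definitions using (DecidableEquality)
open import Relation.Binary.PropositionalEquality

-- Counting ones and increasing selections

bit : Bool → ℕ
bit true  = 1
bit false = 0

ones-cons : ∀ {m} (v : Fin (suc m) → Bool) → ones v ≡ bit (v Fin.zero) + ones (v ∘ Fin.suc)
ones-cons v with v Fin.zero
... | true  = refl
... | false = refl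

Selection : ∀ {m} → (Fin m → Bool) → ℕ → Set
Selection {m} v c = Σ (Fin c → Fin m) λ f → StrictlyIncreasing f × (∀ i → v (f i) ≡ true)

shift : ∀ {m c} {v : Fin (suc m) → Bool} → Selection (v ∘ Fin.suc) c → Selection v c
shift (f , f-inc , f-ok) = Fin.suc ∘ f , (λ i j i<j → s≤s (f-inc i j i<j)) , f-ok

cons : ∀ {m c} {v : Fin (suc m) → Bool} → v Fin.zero ≡ true →
       Selection (v ∘ Fin.suc) c → Selection v (suc c)
cons {m} {c} {v} v0 (f , f-inc , f-ok) = g , g-inc , g-ok
  where
  g : Fin (suc c) → Fin (suc m)
  g Fin.zero    = Fin.zero
  g (Fin.suc i) = Fin.suc (f i)

  g-inc : StrictlyIncreasing g
  g-inc Fin.zero    (Fin.suc j) _         = s≤s z≤n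
  g-inc (Fin.suc i) (Fin.suc j) (s≤s i<j) = s≤s (f-inc i j i<j)

  g-ok : ∀ i → v (g i) ≡ true
  g-ok Fin.zero    = v0
  g-ok (Fin.suc i) = f-ok i

unshift : ∀ {m c} {v : Fin (suc m) → Bool} (sel : Selection v c) →
          (∀ i → proj₁ sel i ≢ Fin.zero) → Selection (v ∘ Fin.suc) c
unshift {m} {c} {v} (f , f-inc , f-ok) nonzero = g , g-inc , g-ok
  where
  predecessor : (x : Fin (suc m)) → x ≢ Fin.zero → Σ (Fin m) λ y → Fin.suc y ≡ x
  predecessor Fin.zero    x≢0 = ⊥-elim (x≢0 refl)
  predecessor (Fin.suc y) _   = y , refl

  g : Fin c → Fin m
  g i = proj₁ (predecessor (f i) (nonzero i))
  suc-g : ∀ i → Fin.suc (g i) ≡ f i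
  suc-g i = proj₂ (predecessor (f i) (nonzero i))

  g-inc : StrictlyIncreasing g
  g-inc i j i<j = s<s⁻¹ (subst₂ Fin._<_ (sym (suc-g i)) (sym (suc-g j)) (f-inc i j i<j))

  g-ok : ∀ i → v (Fin.suc (g i)) ≡ true
  g-ok i = trans (cong v (suc-g i)) (f-ok i)

uncons : ∀ {m c} {v : Fin (suc m) → Bool} → Selection v (suc c) → Selection (v ∘ Fin.suc) c
uncons {v = v} (f , f-inc , f-ok) =
  unshift {v = v} (f ∘ Fin.suc , (λ i j i<j → f-inc _ _ (s≤s i<j)) , f-ok ∘ Fin.suc) after-first
  where
  after-first : ∀ i → f (Fin.suc i) ≢ Fin.zero
  after-first i fi≡0
    with () ← subst (λ x → Fin.toℕ (f Fin.zero) ℕ.< Fin.toℕ x) fi≡0 (f-inc Fin.zero (Fin.suc i) (s≤s z≤n))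

select : ∀ {m} (v : Fin m → Bool) {c} → c ≤ ones v → Selection v c
select v {zero} _ = (λ ()) , (λ ()) , (λ ())
select {zero} v {suc c} ()
select {suc m} v {suc c} c<ones with v Fin.zero in v0
... | true  = cons {v = v} v0 (select (v ∘ Fin.suc) (s≤s⁻¹ c<ones))
... | false = shift {v = v} (select (v ∘ Fin.suc) c<ones)

selection⇒≤ : ∀ {m c} {v : Fin m → Bool} → Selection v c → c ≤ ones v
selection⇒≤ {c = zero} _ = z≤n
selection⇒≤ {zero} {suc c} (f , _) with f Fin.zero
... | ()
selection⇒≤ {suc m} {suc c} {v} sel@(f , _ , f-ok) with v Fin.zero in v0
... | true  = s≤s (selection⇒≤ (uncons {v = v} sel))
... | false = selection⇒≤ (unshift {v = v} sel avoids-zero)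
  where
  avoids-zero : ∀ i → f i ≢ Fin.zero
  avoids-zero i fi≡0 with () ← trans (sym (f-ok i)) (trans (cong v fi≡0) v0)

-- k-sets: Boolean vectors with a prescribed number of ones

weight : ∀ {m} → Vec Bool m → ℕ
weight t = ones (Vec.lookup t)

_∩_ : ∀ {m} → Vec Bool m → Vec Bool m → Vec Bool m
_∩_ = zipWith _∧_

weight-∩ˡ : ∀ {m} (t u : Vec Bool m) → weight (t ∩ u) ≤ weight t
weight-∩ˡ []          []          = z≤n
weight-∩ˡ (true  ∷ t) (true  ∷ u) = s≤s (weight-∩ˡ t u)
weight-∩ˡ (true  ∷ t) (false ∷ u) = m≤n⇒m≤1+n (weight-∩ˡ t u)
weight-∩ˡ (false ∷ t) (_     ∷ u) = weight-∩ˡ t u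

weight-∩ʳ : ∀ {m} (t u : Vec Bool m) → weight (t ∩ u) ≤ weight u
weight-∩ʳ t u = subst (λ w → weight w ≤ weight u) (zipWith-comm ∧-comm u t) (weight-∩ˡ u t)

∩-full⇒≡ : ∀ {m} (t u : Vec Bool m) → weight t ≤ weight (t ∩ u) → weight u ≤ weight (t ∩ u) → t ≡ u
∩-full⇒≡ []          []          _         _         = refl
∩-full⇒≡ (true  ∷ t) (true  ∷ u) (s≤s t≤) (s≤s u≤) = cong (true ∷_) (∩-full⇒≡ t u t≤ u≤)
∩-full⇒≡ (false ∷ t) (false ∷ u) t≤       u≤       = cong (false ∷_) (∩-full⇒≡ t u t≤ u≤)
∩-full⇒≡ (true  ∷ t) (false ∷ u) t≤       _        = ⊥-elim (<-irrefl refl (≤-trans t≤ (weight-∩ˡ t u)))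
∩-full⇒≡ (false ∷ t) (true  ∷ u) _        u≤       = ⊥-elim (<-irrefl refl (≤-trans u≤ (weight-∩ʳ t u)))

common-selection⇒≡ : ∀ {m k} {t u : Vec Bool m} → weight t ≡ k → weight u ≡ k →
                     Selection (Vec.lookup (t ∩ u)) k → t ≡ u
common-selection⇒≡ {t = t} {u} refl u≡k common =
  ∩-full⇒≡ t u (selection⇒≤ common) (subst (_≤ weight (t ∩ u)) (sym u≡k) (selection⇒≤ common))

∅ : ∀ m → Vec Bool m
∅ m = replicate m false

weight-∅ : ∀ m → weight (∅ m) ≡ 0
weight-∅ zero    = refl
weight-∅ (suc m) = weight-∅ m

weight≡0⇒∅ : ∀ {m} (t : Vec Bool m) → weight t ≡ 0 → t ≡ ∅ m
weight≡0⇒∅ []          _  = refl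
weight≡0⇒∅ (false ∷ t) w = cong (false ∷_) (weight≡0⇒∅ t w)

∅-no-ones : ∀ {m} (i : Fin m) → Vec.lookup (∅ m) i ≢ true
∅-no-ones i one with () ← trans (sym (lookup-replicate i false)) one

kSetBelow : ∀ {m} (v : Fin m → Bool) k → k ≤ ones v →
            Σ (Vec Bool m) λ t → weight t ≡ k × (∀ i → Vec.lookup t i ≡ true → v i ≡ true)
kSetBelow {m} v zero _ = ∅ m , weight-∅ m , λ i one → ⊥-elim (∅-no-ones i one)
kSetBelow {zero}  v (suc k) ()
kSetBelow {suc m} v (suc k) k<ones with v Fin.zero in v0
... | true  with t , w , t⊆v ← kSetBelow (v ∘ Fin.suc) k (s≤s⁻¹ k<ones) =
  true ∷ t , cong suc w , λ { Fin.zero _ → v0 ; (Fin.suc i) one → t⊆v i one }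
... | false with t , w , t⊆v ← kSetBelow (v ∘ Fin.suc) (suc k) k<ones =
  false ∷ t , w , λ { (Fin.suc i) one → t⊆v i one }

-- Occurrences in a list and the pigeonhole principle, over any type with
-- decidable equality

module Counting {A : Set} (_≟_ : DecidableEquality A) where

  occurrences : A → List A → ℕ
  occurrences x []       = 0
  occurrences x (y ∷ ys) = bit (does (x ≟ y)) + occurrences x ys

  occurrences-++ : ∀ x (ys zs : List A) →
                   occurrences x (ys ++ zs) ≡ occurrences x ys + occurrences x zs
  occurrences-++ x []       zs = refl
  occurrences-++ x (y ∷ ys) zs =
    trans (cong (bit (does (x ≟ y)) +_) (occurrences-++ x ys zs)) (sym (+-assoc (bit (does (x ≟ y))) _ _))

  repeat : ℕ → List A → List A
  repeat r us = concat (List.replicate r us)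

  length-repeat : ∀ r (us : List A) → length (repeat r us) ≡ r * length us
  length-repeat zero    us = refl
  length-repeat (suc r) us = trans (length-++ us) (cong (length us +_) (length-repeat r us))

  occurrences-repeat : ∀ x r (us : List A) → occurrences x (repeat r us) ≡ r * occurrences x us
  occurrences-repeat x zero    us = refl
  occurrences-repeat x (suc r) us =
    trans (occurrences-++ x us (repeat r us)) (cong (occurrences x us +_) (occurrences-repeat x r us))

  others : A → List A → List A
  others u = List.filter (λ y → ¬? (u ≟ y))

  length-others : ∀ u (ys : List A) → length ys ≡ occurrences u ys + length (others u ys)
  length-others u []       = refl
  length-others u (y ∷ ys) with u ≟ y
  ... | yes _ = cong suc (length-others u ys)
  ... | no  _ = trans (cong suc (length-others u ys)) (sym (+-suc _ _))

  occurrences-others : ∀ x u (ys : List A) → occurrences x (others u ys) ≤ occurrences x ys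
  occurrences-others x u []       = z≤n
  occurrences-others x u (y ∷ ys) with u ≟ y
  ... | yes _ = ≤-trans (occurrences-others x u ys) (m≤n+m _ _)
  ... | no  _ = +-monoʳ-≤ (bit (does (x ≟ y))) (occurrences-others x u ys)

  others-⊆ : ∀ {u us} (ys : List A) → All (_∈ u ∷ us) ys → All (_∈ us) (others u ys)
  others-⊆     []       []             = []
  others-⊆ {u} (y ∷ ys) (y∈ ∷ ys∈) with u ≟ y | y∈
  ... | yes _   | _          = others-⊆ ys ys∈
  ... | no  u≢y | here y≡u   = ⊥-elim (u≢y (sym y≡u))
  ... | no  _   | there y∈us = y∈us ∷ others-⊆ ys ys∈

  pigeonhole : ∀ r (us ys : List A) → All (_∈ us) ys → (∀ x → occurrences x ys ≤ r) →
               length ys ≤ r * length us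
  pigeonhole r []       []       _         _ = z≤n
  pigeonhole r []       (y ∷ ys) (() ∷ _)  _
  pigeonhole r (u ∷ us) ys       ys∈       few = begin
    length ys                               ≡⟨ length-others u ys ⟩
    occurrences u ys + length (others u ys) ≤⟨ +-mono-≤ (few u) rest ⟩
    r + r * length us                       ≡⟨ sym (*-suc r (length us)) ⟩
    r * suc (length us)                     ∎
    where
    open ≤-Reasoning
    rest : length (others u ys) ≤ r * length us
    rest = pigeonhole r us (others u ys) (others-⊆ ys ys∈)
             (λ x → ≤-trans (occurrences-others x u ys) (few x))

-- The list of all k-sets

_≟_ : ∀ {m} → DecidableEquality (Vec Bool m)
_≟_ = ≡-dec Bool._≟_

module _ {m : ℕ} where
  open Counting (_≟_ {m}) public

-- all k-sets of length m, by the position-0 recursion behind Pascal's rule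
kSets : (m k : ℕ) → List (Vec Bool m)
kSets m       zero    = ∅ m ∷ []
kSets zero    (suc k) = []
kSets (suc m) (suc k) = map (true ∷_) (kSets m k) ++ map (false ∷_) (kSets m (suc k))

length-kSets : ∀ m k → length (kSets m k) ≡ m C k
length-kSets m       zero    = sym (trans (nCk≡nC[n∸k] {0} {m} z≤n) (nCn≡1 m))
length-kSets zero    (suc k) = sym (k>n⇒nCk≡0 {0} {suc k} (s≤s z≤n))
length-kSets (suc m) (suc k) = begin
  length (map (true ∷_) (kSets m k) ++ map (false ∷_) (kSets m (suc k)))
    ≡⟨ length-++ (map (true ∷_) (kSets m k)) ⟩
  length (map (true ∷_) (kSets m k)) + length (map (false ∷_) (kSets m (suc k)))
    ≡⟨ cong₂ _+_ (length-map (true ∷_) (kSets m k)) (length-map (false ∷_) (kSets m (suc k))) ⟩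
  length (kSets m k) + length (kSets m (suc k))
    ≡⟨ cong₂ _+_ (length-kSets m k) (length-kSets m (suc k)) ⟩
  m C k + m C suc k
    ≡⟨ nCk+nC[k+1]≡[n+1]C[k+1] m k ⟩
  suc m C suc k ∎
  where open ≡-Reasoning

kSets-sound : ∀ m k → All (λ t → weight t ≡ k) (kSets m k)
kSets-sound m       zero    = weight-∅ m ∷ []
kSets-sound zero    (suc k) = []
kSets-sound (suc m) (suc k) =
  ++⁺ (map⁺ (All.map (cong suc) (kSets-sound m k))) (map⁺ (kSets-sound m (suc k)))

kSets-complete : ∀ {m k} (t : Vec Bool m) → weight t ≡ k → t ∈ kSets m k
kSets-complete {k = zero}  t           w = here (weight≡0⇒∅ t w)
kSets-complete {k = suc k} (true  ∷ t) w =
  ∈-++⁺ˡ (∈-map⁺ (true ∷_) (kSets-complete t (suc-injective w)))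
kSets-complete {k = suc k} (false ∷ t) w =
  ∈-++⁺ʳ (map (true ∷_) (kSets _ k)) (∈-map⁺ (false ∷_) (kSets-complete t w))

occurrences-map-∷ : ∀ {m} b (s : Vec Bool m) ts → occurrences (b ∷ s) (map (b ∷_) ts) ≡ occurrences s ts
occurrences-map-∷ b     s []       = refl
occurrences-map-∷ true  s (t ∷ ts) = cong (bit (does (s ≟ t)) +_) (occurrences-map-∷ true s ts)
occurrences-map-∷ false s (t ∷ ts) = cong (bit (does (s ≟ t)) +_) (occurrences-map-∷ false s ts)

occurrences-map-∷-other : ∀ {m} b (s : Vec Bool m) ts → occurrences (b ∷ s) (map (Bool.not b ∷_) ts) ≡ 0
occurrences-map-∷-other b     s []       = refl
occurrences-map-∷-other true  s (t ∷ ts) = occurrences-map-∷-other true s ts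
occurrences-map-∷-other false s (t ∷ ts) = occurrences-map-∷-other false s ts

kSets-unique : ∀ m k (s : Vec Bool m) → occurrences s (kSets m k) ≤ 1
kSets-unique m       zero    s with does (s ≟ ∅ m)
... | true  = ≤-refl
... | false = z≤n
kSets-unique zero    (suc k) s = z≤n
kSets-unique (suc m) (suc k) (true ∷ s) rewrite
    occurrences-++ (true ∷ s) (map (true ∷_) (kSets m k)) (map (false ∷_) (kSets m (suc k)))
  | occurrences-map-∷ true s (kSets m k)
  | occurrences-map-∷-other true s (kSets m (suc k))
  | +-identityʳ (occurrences s (kSets m k)) = kSets-unique m k s
kSets-unique (suc m) (suc k) (false ∷ s) rewrite
    occurrences-++ (false ∷ s) (map (true ∷_) (kSets m k)) (map (false ∷_) (kSets m (suc k)))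
  | occurrences-map-∷-other false s (kSets m k)
  | occurrences-map-∷ false s (kSets m (suc k)) = kSets-unique m (suc k) s

-- Matrices given by their columns

fromColumns : ∀ {m n} → (Fin n → Vec Bool m) → Matrix m n
fromColumns S i j = Vec.lookup (S j) i

multiplicity : ∀ {m n} → Vec Bool m → (Fin n → Vec Bool m) → ℕ
multiplicity s S = occurrences s (tabulate S)

multiplicity-ones : ∀ {m n} (s : Vec Bool m) (S : Fin n → Vec Bool m) →
                    multiplicity s S ≡ ones (λ j → does (s ≟ S j))
multiplicity-ones {n = zero}  s S = refl
multiplicity-ones {n = suc n} s S =
  trans (cong (bit (does (s ≟ S Fin.zero)) +_) (multiplicity-ones s (S ∘ Fin.suc)))
        (sym (ones-cons (λ j → does (s ≟ S j))))

≟-sound : ∀ {m} (s t : Vec Bool m) → does (s ≟ t) ≡ true → s ≡ t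
≟-sound s t same with s ≟ t
... | yes s≡t = s≡t

contains-mono : ∀ {m n r c} {A B : Matrix m n} {P : Matrix r c} →
                (∀ i j → B i j ≡ true → A i j ≡ true) → Contains B P → Contains A P
contains-mono B⊆A (f , g , f-inc , g-inc , hit) =
  f , g , f-inc , g-inc , λ i j one → B⊆A (f i) (g j) (hit i j one)

repeated⇒contains : ∀ {m n k c} (S : Fin n → Vec Bool m) →
                    (∀ j → weight (S j) ≡ k) → ∀ s → suc c ≤ multiplicity s S →
                    Contains (fromColumns S) (AllOnes k (suc c))
repeated⇒contains {c = c} S w s many
  with g , g-inc , g-ok ← select (λ j → does (s ≟ S j)) (subst (suc c ≤_) (multiplicity-ones s S) many)
  with s-weight ← trans (cong weight (≟-sound s (S (g Fin.zero)) (g-ok Fin.zero))) (w (g Fin.zero))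
  with f , f-inc , f-ok ← select (Vec.lookup s) (≤-reflexive (sym s-weight))
  = f , g , f-inc , g-inc , λ i j _ → subst (λ t → Vec.lookup t (f i) ≡ true) (≟-sound s (S (g j)) (g-ok j)) (f-ok i)

contains⇒repeated : ∀ {m n k c} (S : Fin n → Vec Bool m) → (∀ j → weight (S j) ≡ k) →
                    Contains (fromColumns S) (AllOnes k (suc c)) →
                    Σ (Vec Bool m) λ s → suc c ≤ multiplicity s S
contains⇒repeated {m} {c = c} S w (f , g , f-inc , g-inc , hit) =
  s , subst (suc c ≤_) (sym (multiplicity-ones s S)) (selection⇒≤ copies)
  where
  s : Vec Bool m
  s = S (g Fin.zero)

  s≡S : ∀ j → s ≡ S (g j)
  s≡S j = common-selection⇒≡ (w (g Fin.zero)) (w (g j)) (f , f-inc , both)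
    where
    both : ∀ i → Vec.lookup (s ∩ S (g j)) (f i) ≡ true
    both i = trans (lookup-zipWith _∧_ (f i) s (S (g j))) (cong₂ _∧_ (hit i Fin.zero refl) (hit i j refl))

  copies : Selection (λ j → does (s ≟ S j)) (suc c)
  copies = g , g-inc , λ j → dec-true (s ≟ S (g j)) (s≡S j)

upperBound : ∀ m k c n (A : Matrix m n) → Admissible k (AllOnes k (suc c)) A → n ≤ c * (m C k)
upperBound m k c n A (avoids , full) = begin
  n                      ≡⟨ sym (length-tabulate S) ⟩
  length (tabulate S)    ≤⟨ pigeonhole c (kSets m k) (tabulate S) in-kSets few-copies ⟩
  c * length (kSets m k) ≡⟨ cong (c *_) (length-kSets m k) ⟩
  c * (m C k)            ∎
  where
  open ≤-Reasoning
  below : ∀ j → Σ (Vec Bool m) λ t → weight t ≡ k × (∀ i → Vec.lookup t i ≡ true → A i j ≡ true)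
  below j = kSetBelow (column A j) k (full j)

  S : Fin n → Vec Bool m
  S j = proj₁ (below j)

  S-weight : ∀ j → weight (S j) ≡ k
  S-weight j = proj₁ (proj₂ (below j))

  in-kSets : All (_∈ kSets m k) (tabulate S)
  in-kSets = tabulate⁺ (λ j → kSets-complete (S j) (S-weight j))

  few-copies : ∀ s → occurrences s (tabulate S) ≤ c
  few-copies s = ≮⇒≥ λ many →
    avoids (contains-mono (λ i j → proj₂ (proj₂ (below j)) i) (repeated⇒contains S S-weight s many))

construction : ∀ m k c → Σ (Matrix m (c * (m C k))) (Admissible k (AllOnes k (suc c)))
construction m k c =
  subst (λ n → Σ (Matrix m n) (Admissible k (AllOnes k (suc c)))) size (fromColumns S , avoids , full)
  where
  columns : List (Vec Bool m)
  columns = repeat c (kSets m k)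

  S : Fin (length columns) → Vec Bool m
  S = List.lookup columns

  size : length columns ≡ c * (m C k)
  size = trans (length-repeat c (kSets m k)) (cong (c *_) (length-kSets m k))

  S-weight : ∀ j → weight (S j) ≡ k
  S-weight j = All.lookup (concat⁺ (replicate⁺ c (kSets-sound m k))) (∈-lookup j)

  full : ∀ j → k ≤ ones (column (fromColumns S) j)
  full j = ≤-reflexive (sym (S-weight j))

  few : ∀ s → occurrences s columns ≤ c
  few s = begin
    occurrences s columns         ≡⟨ occurrences-repeat s c (kSets m k) ⟩
    c * occurrences s (kSets m k) ≤⟨ *-monoʳ-≤ c (kSets-unique m k s) ⟩
    c * 1                         ≡⟨ *-identityʳ c ⟩
    c                             ∎
    where open ≤-Reasoning

  -- a copy of P_{k,c+1} would need some k-set c+1 times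
  avoids : Avoids (fromColumns S) (AllOnes k (suc c))
  avoids copy with s , many ← contains⇒repeated S S-weight copy =
    <-irrefl refl (≤-trans many (subst (_≤ c) (cong (occurrences s) (sym (tabulate-lookup columns))) (few s)))

mainTheorem4 : ∀ (m k c : ℕ) → 1 ≤ m → 1 ≤ k → 1 ≤ c →
    IsExK k m (AllOnes k c) ((c ∸ 1) * (m C k))
mainTheorem4 m k zero    _ _ ()
mainTheorem4 m k (suc c) _ _ _ = construction m k c , upperBound m k c
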